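{- Let $m,n\ge 0$ be fixed integers with $(m,n)\neq(0,1)$ and $(m,n)\neq(0,0)$. For $k\ge 1$, let $G_k$ be a random $(m,n)$-colored mixed graph on the vertex set $\{1,\dots,k\}$ in which, independently for each pair of vertices, the adjacency type between them is chosen uniformly at random among the $2m+n+1$ possibilities (an arc of one of the $m$ colors in one of the two directions, an edge of one of the $n$ colors, or non-adjacency). Then the probability that $G_k$ is an $(m,n)$-clique tends to $1$ as $k\to\infty$.
   Context: An $(m,n)$-colored mixed graph has arcs colored with $m$ colors and edges colored with $n$ colors, with simple underlying undirected graph. A homomorphism $f:G\to H$ maps vertices to vertices so that every arc (resp. edge) $uv$ of color $c$ is sent to an arc (resp. edge) $f(u)f(v)$ of color $c$ (arcs keep direction). $\chi_{(m,n)}(G)$ is the minimum order of an $H$ with $G\to H$, and $G$ is an $(m,n)$-clique if $\chi_{(m,n)}(G)$ equals the number of vertices of $G$. -}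

module Defs where

open import Data.Nat using (ℕ; zero; suc; _+_; _*_; _^_; _<_)
open import Data.Nat.Combinatorics using (_C_)
open import Data.Fin using (Fin; zero; suc)
open import Data.Vec using (Vec; []; _∷_; lookup)
open import Data.Product using (Σ; ∃; _×_; _,_)
open import Data.List using (List)
open import Relation.Binary.PropositionalEquality using (_≡_; _≢_)
open import Relation.Nullary using (¬_)

-- The 2m+n+1 possible adjacency types between an ordered pair (u , v):
--   none      : non-adjacent
--   edge c    : an edge of colour c (c < n)
--   out c     : an arc u → v of colour c (c < m)
--   inn c     : an arc v → u of colour c (c < m)
data Adj (m n : ℕ) : Set where
  none : Adj m n
  edge : Fin n → Adj m n
  out  : Fin m → Adj m n
  inn  : Fin m → Adj m n

flipAdj : ∀ {m n} → Adj m n → Adj m n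
flipAdj none     = none
flipAdj (edge c) = edge c
flipAdj (out c)  = inn c
flipAdj (inn c)  = out c

-- An (m,n)-coloured mixed graph (simple underlying graph) on the vertex set Fin k,
-- encoded canonically: a graph on k+1 vertices is a graph on the first k vertices
-- together with, for the new (last) vertex w and each old vertex v, the adjacency
-- type of the ordered pair (w , v).  Every such graph has a unique encoding, so
-- there are exactly (2m+n+1)^(k C 2) graphs on Fin k.
data MixedGraph (m n : ℕ) : ℕ → Set where
  empty : MixedGraph m n zero
  extend : ∀ {k} → MixedGraph m n k → Vec (Adj m n) k → MixedGraph m n (suc k)

adj : ∀ {m n k} → MixedGraph m n k → Fin k → Fin k → Adj m n
adj (extend G r) zero    zero    = none
adj (extend G r) zero    (suc v) = lookup r v  -- zero = the newest vertex, suc v = old vertex v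
adj (extend G r) (suc u) zero    = flipAdj (lookup r u)
adj (extend G r) (suc u) (suc v) = adj G u v

IsHom : ∀ {m n k j} → MixedGraph m n k → MixedGraph m n j → (Fin k → Fin j) → Set
IsHom G H f = ∀ u v → adj G u v ≢ none → adj H (f u) (f v) ≡ adj G u v

Hom : ∀ {m n k j} → MixedGraph m n k → MixedGraph m n j → Set
Hom G H = Σ _ (IsHom G H)

-- G is an (m,n)-clique iff χ_(m,n)(G) = |V(G)| = k, i.e. (since G → G)
-- there is no (m,n)-coloured mixed graph H of order j < k with G → H.
-- (Every finite H is isomorphic to a MixedGraph on Fin j, j = |V(H)|.)
IsClique : ∀ {m n k} → MixedGraph m n k → Set
IsClique {m} {n} {k} G = ¬ (Σ ℕ λ j → j < k × Σ (MixedGraph m n j) λ H → Hom G H)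

-- size of the (uniform) sample space of graphs on k vertices
total : ℕ → ℕ → ℕ → ℕ
total m n k = (2 * m + n + 1) ^ (k C 2)

module Submission where

open import Defs
open import Data.Nat using (ℕ; _*_; _≤_; _≥_)
open import Data.Product using (∃; _×_; _,_)
open import Data.List using (List; length)
open import Data.List.Relation.Unary.All using (All)
open import Data.List.Relation.Unary.Unique.Propositional using (Unique)
open import Relation.Binary.PropositionalEquality using (_≢_)
open import Relation.Nullary using (¬_)

open import Level using (0ℓ)
open import Data.Empty using (⊥-elim)
open import Data.Sum using (_⊎_; inj₁; inj₂)
open import Data.Product using (Σ; ∃₂; proj₁; proj₂)
open import Data.Nat using (zero; suc; _+_; _^_; _<_; _∸_; s≤s; z≤n; _≤?_)
open import Data.Nat.Properties
  using (≤-reflexive; ≤-trans; <⇒≢; n≤1+n; m≤m+n; m≤n+m; +-identityʳ; +-suc; +-assoc; +-comm;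
         +-monoʳ-≤; +-mono-≤; *-identityʳ; *-monoʳ-≤; *-monoˡ-≤; *-mono-≤; *-assoc; *-cancelˡ-≤;
         ^-monoˡ-≤; ^-monoʳ-≤; ^-*-assoc; ^-distribˡ-+-*; m+[n∸m]≡n; module ≤-Reasoning)
open import Data.Nat.Combinatorics using (_C_; nC1≡n; nCk+nC[k+1]≡[n+1]C[k+1])
open import Data.Nat.Tactic.RingSolver using (solve-∀)
open import Data.Fin using (Fin; zero; suc; toℕ)
open import Data.Fin.Properties using (pigeonhole) renaming (_≟_ to _≟ᶠ_)
open import Data.Fin.Permutation.Components using (transpose; transpose-inverse)
open import Data.Vec using (Vec; []; _∷_; lookup; tabulate)
open import Data.Vec.Properties using (lookup∘tabulate; tabulate∘lookup; tabulate-cong)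
open import Data.List using ([]; _∷_; [_]; _++_; map; allFin; cartesianProductWith)
open import Data.List.Properties using (length-++; length-map; length-tabulate)
open import Data.List.Membership.Propositional using (_∈_)
open import Data.List.Membership.Propositional.Properties
  using (∈-++⁺ˡ; ∈-++⁺ʳ; ∈-map⁺; ∈-allFin; ∈-cartesianProductWith⁺)
open import Data.List.Relation.Binary.Subset.Propositional using (_⊆_)
open import Data.List.Relation.Unary.Any using (here; there)
import Data.List.Relation.Unary.All as All
open import Data.List.Relation.Unary.AllPairs using ([]; _∷_)
open import Relation.Binary.PropositionalEquality
  using (_≡_; refl; sym; trans; cong; cong₂; subst; subst₂; module ≡-Reasoning)
open import Relation.Nullary using (Dec; yes; no)
open import Relation.Nullary.Negation using (¬¬-Monad; ¬¬-map)
open import Relation.Nullary.Decidable using (decidable-stable)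

-- Write s = 2m+n+1 for the number of adjacency types, so there are s^(k C 2) graphs
-- on k vertices.  If G is not a clique, it maps homomorphically onto a smaller graph,
-- so (pigeonhole) two distinct vertices u, v are identified; such u, v are *twins*:
-- non-adjacent, and for every w the types of uw and vw are *compatible* (one of them
-- is `none`, or they are equal).  There are only q = 3s-2 compatible pairs of types
-- among s², so graphs on k+2 vertices in which 0 and 1 are twins number
-- s^(k C 2) · q^k; relabelling vertices, every graph with a twin pair lies in an
-- explicit list `candidates` of length (k+2)² · s^(k C 2) · q^k.  Since
-- (m,n) ∉ {(0,0),(0,1)} we have s ≥ 3, hence q+1 ≤ s², and as (q+1)^k eventually
-- beats N (k+2)² q^k, the candidates are at most a 1/N fraction of all s^((k+2) C 2)
-- graphs.  A duplicate-free list of non-cliques is contained in `candidates`, which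
-- bounds its length.

length-cartesianProductWith : ∀ {A B C : Set} (f : A → B → C) (xs : List A) (ys : List B) →
  length (cartesianProductWith f xs ys) ≡ length xs * length ys
length-cartesianProductWith f [] ys = refl
length-cartesianProductWith f (x ∷ xs) ys = begin
  length (map (f x) ys ++ cartesianProductWith f xs ys)
    ≡⟨ length-++ (map (f x) ys) ⟩
  length (map (f x) ys) + length (cartesianProductWith f xs ys)
    ≡⟨ cong₂ _+_ (length-map (f x) ys) (length-cartesianProductWith f xs ys) ⟩
  length ys + length xs * length ys ∎
  where open ≡-Reasoning

suc-C-2 : ∀ k → suc k C 2 ≡ k C 2 + k
suc-C-2 k = begin
  suc k C 2        ≡⟨ sym (nCk+nC[k+1]≡[n+1]C[k+1] k 1) ⟩
  k C 1 + k C 2    ≡⟨ cong (_+ k C 2) (nC1≡n k) ⟩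
  k + k C 2        ≡⟨ +-comm k (k C 2) ⟩
  k C 2 + k        ∎
  where open ≡-Reasoning

module _ {A : Set} where

  delete : ∀ {x : A} (ys : List A) → x ∈ ys → List A
  delete (y ∷ ys) (here _)  = ys
  delete (y ∷ ys) (there p) = y ∷ delete ys p

  length-delete : ∀ {x : A} (ys : List A) (p : x ∈ ys) → suc (length (delete ys p)) ≡ length ys
  length-delete (y ∷ ys) (here _)  = refl
  length-delete (y ∷ ys) (there p) = cong suc (length-delete ys p)

  ∈-delete : ∀ {x z : A} (ys : List A) (p : x ∈ ys) → z ∈ ys → z ≢ x → z ∈ delete ys p
  ∈-delete (y ∷ ys) (here refl) (here refl) z≢x = ⊥-elim (z≢x refl)
  ∈-delete (y ∷ ys) (here refl) (there q)   z≢x = q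
  ∈-delete (y ∷ ys) (there p)   (here z≡y)  z≢x = here z≡y
  ∈-delete (y ∷ ys) (there p)   (there q)   z≢x = there (∈-delete ys p q z≢x)

  unique-⊆⇒length≤ : ∀ {xs ys : List A} → Unique xs → xs ⊆ ys → length xs ≤ length ys
  unique-⊆⇒length≤ {[]}     _              _   = z≤n
  unique-⊆⇒length≤ {x ∷ xs} {ys} (x∉xs ∷ uniq) xs⊆ys =
    subst (suc (length xs) ≤_) (length-delete ys x∈ys)
      (s≤s (unique-⊆⇒length≤ uniq xs⊆rest))
    where
    x∈ys : x ∈ ys
    x∈ys = xs⊆ys (here refl)
    z≢x : ∀ {z} → z ∈ xs → z ≢ x
    z≢x z∈xs z≡x = All.lookup x∉xs z∈xs (sym z≡x)
    xs⊆rest : xs ⊆ delete ys x∈ys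
    xs⊆rest z∈xs = ∈-delete ys x∈ys (xs⊆ys (there z∈xs)) (z≢x z∈xs)

module _ {m n : ℕ} where

  none? : (a : Adj m n) → Dec (a ≡ none)
  none? none     = yes refl
  none? (edge _) = no λ ()
  none? (out _)  = no λ ()
  none? (inn _)  = no λ ()

  -- Types of uw and vw that can both be sent to the type of f(u)f(w) when f(u) = f(v).
  Compatible : Adj m n → Adj m n → Set
  Compatible a b = a ≡ none ⊎ b ≡ none ⊎ a ≡ b

  agree⇒compatible : ∀ {a b c : Adj m n} → (a ≢ none → c ≡ a) → (b ≢ none → c ≡ b) →
    Compatible a b
  agree⇒compatible {a} {b} c≡a c≡b with none? a | none? b
  ... | yes a≡none | _          = inj₁ a≡none
  ... | no _       | yes b≡none = inj₂ (inj₁ b≡none)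
  ... | no a≢none  | no b≢none  = inj₂ (inj₂ (trans (sym (c≡a a≢none)) (c≡b b≢none)))

  agree-none : ∀ {a c : Adj m n} → (a ≢ none → c ≡ a) → c ≡ none → a ≡ none
  agree-none {a} c≡a c≡none with none? a
  ... | yes a≡none = a≡none
  ... | no a≢none  = trans (sym (c≡a a≢none)) c≡none

  present : List (Adj m n)
  present = map edge (allFin n) ++ map out (allFin m) ++ map inn (allFin m)

  allAdj : List (Adj m n)
  allAdj = none ∷ present

  length-present : length present ≡ n + (m + m)
  length-present = begin
    length present
      ≡⟨ length-++ (map edge (allFin n)) ⟩
    length (map edge (allFin n)) + length (map out (allFin m) ++ map inn (allFin m))
      ≡⟨ cong (length (map edge (allFin n)) +_) (length-++ (map out (allFin m))) ⟩
    length (map edge (allFin n)) + (length (map out (allFin m)) + length (map inn (allFin m)))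
      ≡⟨ cong₂ _+_ (length-allFin-map edge) (cong₂ _+_ (length-allFin-map out) (length-allFin-map inn)) ⟩
    n + (m + m) ∎
    where
    open ≡-Reasoning
    length-allFin-map : ∀ {j} (f : Fin j → Adj m n) → length (map f (allFin j)) ≡ j
    length-allFin-map f = trans (length-map f (allFin _)) (length-tabulate (λ i → i))

  none-or-present : (a : Adj m n) → a ≡ none ⊎ a ∈ present
  none-or-present none     = inj₁ refl
  none-or-present (edge c) = inj₂ (∈-++⁺ˡ (∈-map⁺ edge (∈-allFin c)))
  none-or-present (out c)  =
    inj₂ (∈-++⁺ʳ (map edge (allFin n)) (∈-++⁺ˡ (∈-map⁺ out (∈-allFin c))))
  none-or-present (inn c)  =
    inj₂ (∈-++⁺ʳ (map edge (allFin n)) (∈-++⁺ʳ (map out (allFin m)) (∈-map⁺ inn (∈-allFin c))))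

  ∈-allAdj : (a : Adj m n) → a ∈ allAdj
  ∈-allAdj a with none-or-present a
  ... | inj₁ refl = here refl
  ... | inj₂ a∈present = there a∈present

  noneFirst noneSecond diagonal : Adj m n → Adj m n × Adj m n
  noneFirst  b = none , b
  noneSecond a = a , none
  diagonal   a = a , a

  compatiblePairs : List (Adj m n × Adj m n)
  compatiblePairs = map noneFirst allAdj ++ map noneSecond present ++ map diagonal present

  length-compatiblePairs :
    length compatiblePairs ≡ suc (n + (m + m)) + ((n + (m + m)) + (n + (m + m)))
  length-compatiblePairs = begin
    length compatiblePairs
      ≡⟨ length-++ (map noneFirst allAdj) {map noneSecond present ++ map diagonal present} ⟩
    length (map noneFirst allAdj) + length (map noneSecond present ++ map diagonal present)
      ≡⟨ cong (length (map noneFirst allAdj) +_) (length-++ (map noneSecond present) {map diagonal present}) ⟩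
    length (map noneFirst allAdj)
      + (length (map noneSecond present) + length (map diagonal present))
      ≡⟨ cong₂ _+_ (length-map noneFirst allAdj)
           (cong₂ _+_ (length-map noneSecond present) (length-map diagonal present)) ⟩
    length allAdj + (length present + length present)
      ≡⟨ cong (λ d → suc d + (d + d)) length-present ⟩
    suc (n + (m + m)) + ((n + (m + m)) + (n + (m + m))) ∎
    where open ≡-Reasoning

  ∈-compatiblePairs : ∀ {a b : Adj m n} → Compatible a b → (a , b) ∈ compatiblePairs
  ∈-compatiblePairs {b = b} (inj₁ refl) = ∈-++⁺ˡ (∈-map⁺ noneFirst (∈-allAdj b))
  ∈-compatiblePairs {a} {b} (inj₂ b≡none⊎a≡b) with none-or-present a | b≡none⊎a≡b
  ... | inj₁ refl | _ = ∈-++⁺ˡ (∈-map⁺ noneFirst (∈-allAdj b))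
  ... | inj₂ a∈present | inj₁ refl =
    ∈-++⁺ʳ (map noneFirst allAdj) (∈-++⁺ˡ (∈-map⁺ noneSecond a∈present))
  ... | inj₂ a∈present | inj₂ refl =
    ∈-++⁺ʳ (map noneFirst allAdj) (∈-++⁺ʳ (map noneSecond present) (∈-map⁺ diagonal a∈present))

  flipAdj-involutive : (a : Adj m n) → flipAdj (flipAdj a) ≡ a
  flipAdj-involutive none     = refl
  flipAdj-involutive (edge _) = refl
  flipAdj-involutive (out _)  = refl
  flipAdj-involutive (inn _)  = refl

  adj-irreflexive : ∀ {k} (G : MixedGraph m n k) u → adj G u u ≡ none
  adj-irreflexive (extend G r) zero    = refl
  adj-irreflexive (extend G r) (suc u) = adj-irreflexive G u

  adj-flip : ∀ {k} (G : MixedGraph m n k) u v → adj G v u ≡ flipAdj (adj G u v)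
  adj-flip (extend G r) zero    zero    = refl
  adj-flip (extend G r) zero    (suc v) = refl
  adj-flip (extend G r) (suc u) zero    = sym (flipAdj-involutive _)
  adj-flip (extend G r) (suc u) (suc v) = adj-flip G u v

  build : ∀ {k} → (Fin k → Fin k → Adj m n) → MixedGraph m n k
  build {zero}  F = empty
  build {suc k} F = extend (build λ a b → F (suc a) (suc b)) (tabulate λ v → F zero (suc v))

  adj-build : ∀ {k} (F : Fin k → Fin k → Adj m n) → (∀ a → F a a ≡ none) →
    (∀ a b → F b a ≡ flipAdj (F a b)) → ∀ a b → adj (build F) a b ≡ F a b
  adj-build {suc k} F irr flp zero    zero    = sym (irr zero)
  adj-build {suc k} F irr flp zero    (suc b) = lookup∘tabulate _ b
  adj-build {suc k} F irr flp (suc a) zero    =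
    trans (cong flipAdj (lookup∘tabulate _ a)) (sym (flp zero (suc a)))
  adj-build {suc k} F irr flp (suc a) (suc b) =
    adj-build (λ a b → F (suc a) (suc b)) (λ a → irr (suc a)) (λ a b → flp (suc a) (suc b)) a b

  graph-ext : ∀ {k} (G H : MixedGraph m n k) → (∀ a b → adj G a b ≡ adj H a b) → G ≡ H
  graph-ext empty        empty        same = refl
  graph-ext (extend G r) (extend H s) same =
    cong₂ extend (graph-ext G H λ a b → same (suc a) (suc b))
      (trans (sym (tabulate∘lookup r)) (trans (tabulate-cong λ v → same zero (suc v)) (tabulate∘lookup s)))

  relabel : ∀ {k} → (Fin k → Fin k) → MixedGraph m n k → MixedGraph m n k
  relabel π G = build λ a b → adj G (π a) (π b)

  adj-relabel : ∀ {k} π (G : MixedGraph m n k) a b → adj (relabel π G) a b ≡ adj G (π a) (π b)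
  adj-relabel π G = adj-build _ (λ a → adj-irreflexive G (π a)) (λ a b → adj-flip G (π a) (π b))

  Twins : ∀ {k} → MixedGraph m n k → Fin k → Fin k → Set
  Twins G u v = u ≢ v × adj G u v ≡ none × (∀ w → Compatible (adj G u w) (adj G v w))

  HomToSmaller : ∀ {k} → MixedGraph m n k → Set
  HomToSmaller {k} G = Σ ℕ λ j → j < k × Σ (MixedGraph m n j) λ H → Hom G H

  identified⇒twins : ∀ {k j} {G : MixedGraph m n k} {H : MixedGraph m n j} {f : Fin k → Fin j} →
    IsHom G H f → ∀ {u v} → u ≢ v → f u ≡ f v → Twins G u v
  identified⇒twins {G = G} {H} {f} hom {u} {v} u≢v fu≡fv =
    u≢v , agree-none (hom u v) H-loop , λ w → agree⇒compatible (hom u w) (via-v w)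
    where
    H-loop : adj H (f u) (f v) ≡ none
    H-loop = trans (cong (λ x → adj H x (f v)) fu≡fv) (adj-irreflexive H (f v))
    via-v : ∀ w → adj G v w ≢ none → adj H (f u) (f w) ≡ adj G v w
    via-v w vw-present = trans (cong (λ x → adj H x (f w)) fu≡fv) (hom v w vw-present)

  smaller⇒twins : ∀ {k} {G : MixedGraph m n k} → HomToSmaller G → ∃₂ (Twins G)
  smaller⇒twins {G = G} (j , j<k , H , f , hom) with pigeonhole j<k f
  ... | u , v , u<v , fu≡fv =
    u , v , identified⇒twins {G = G} {H} hom (λ u≡v → <⇒≢ u<v (cong toℕ u≡v)) fu≡fv

  twins-relabel : ∀ {k} (π : Fin k → Fin k) {G : MixedGraph m n k} {a b} →
    a ≢ b → Twins G (π a) (π b) → Twins (relabel π G) a b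
  twins-relabel π {G} {a} {b} a≢b (_ , πa-πb , compat) =
    a≢b , trans (adj-relabel π G a b) πa-πb ,
    λ w → subst₂ Compatible (sym (adj-relabel π G a w)) (sym (adj-relabel π G b w)) (compat (π w))

  allRows : ∀ k → List (Vec (Adj m n) k)
  allRows zero    = [ [] ]
  allRows (suc k) = cartesianProductWith _∷_ allAdj (allRows k)

  ∈-allRows : ∀ {k} (r : Vec (Adj m n) k) → r ∈ allRows k
  ∈-allRows []      = here refl
  ∈-allRows (a ∷ r) = ∈-cartesianProductWith⁺ _∷_ (∈-allAdj a) (∈-allRows r)

  length-allRows : ∀ k → length (allRows k) ≡ suc (n + (m + m)) ^ k
  length-allRows zero    = refl
  length-allRows (suc k) = trans (length-cartesianProductWith _∷_ allAdj (allRows k))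
    (cong₂ _*_ (cong suc length-present) (length-allRows k))

  allGraphs : ∀ k → List (MixedGraph m n k)
  allGraphs zero    = [ empty ]
  allGraphs (suc k) = cartesianProductWith extend (allGraphs k) (allRows k)

  ∈-allGraphs : ∀ {k} (G : MixedGraph m n k) → G ∈ allGraphs k
  ∈-allGraphs empty        = here refl
  ∈-allGraphs (extend G r) = ∈-cartesianProductWith⁺ extend (∈-allGraphs G) (∈-allRows r)

  length-allGraphs : ∀ k → length (allGraphs k) ≡ suc (n + (m + m)) ^ (k C 2)
  length-allGraphs zero    = refl
  length-allGraphs (suc k) = begin
    length (cartesianProductWith extend (allGraphs k) (allRows k))
      ≡⟨ length-cartesianProductWith extend (allGraphs k) (allRows k) ⟩
    length (allGraphs k) * length (allRows k)
      ≡⟨ cong₂ _*_ (length-allGraphs k) (length-allRows k) ⟩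
    s ^ (k C 2) * s ^ k
      ≡⟨ sym (^-distribˡ-+-* s (k C 2) k) ⟩
    s ^ (k C 2 + k)
      ≡⟨ cong (s ^_) (sym (suc-C-2 k)) ⟩
    s ^ (suc k C 2) ∎
    where
    open ≡-Reasoning
    s = suc (n + (m + m))

  consRows : ∀ {k} → Adj m n × Adj m n → Vec (Adj m n) k × Vec (Adj m n) k →
    Vec (Adj m n) (suc k) × Vec (Adj m n) (suc k)
  consRows (a , b) (r , s) = a ∷ r , b ∷ s

  compatibleRows : ∀ k → List (Vec (Adj m n) k × Vec (Adj m n) k)
  compatibleRows zero    = [ [] , [] ]
  compatibleRows (suc k) = cartesianProductWith consRows compatiblePairs (compatibleRows k)

  ∈-compatibleRows : ∀ {k} (r s : Vec (Adj m n) k) →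
    (∀ w → Compatible (lookup r w) (lookup s w)) → (r , s) ∈ compatibleRows k
  ∈-compatibleRows []      []      compat = here refl
  ∈-compatibleRows (a ∷ r) (b ∷ s) compat = ∈-cartesianProductWith⁺ consRows
    (∈-compatiblePairs (compat zero)) (∈-compatibleRows r s λ w → compat (suc w))

  length-compatibleRows : ∀ k → length (compatibleRows k) ≡ length compatiblePairs ^ k
  length-compatibleRows zero    = refl
  length-compatibleRows (suc k) =
    trans (length-cartesianProductWith consRows compatiblePairs (compatibleRows k))
      (cong (length compatiblePairs *_) (length-compatibleRows k))

  -- G extended by a vertex 1 with row s and a vertex 0 with row r, not adjacent to 1;
  -- for compatible (r , s) these are exactly the graphs in which 0 and 1 are twins.
  joinTwins : ∀ {k} → MixedGraph m n k → Vec (Adj m n) k × Vec (Adj m n) k →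
    MixedGraph m n (suc (suc k))
  joinTwins G (r , s) = extend (extend G s) (none ∷ r)

  twinsAtFront : ∀ k → List (MixedGraph m n (suc (suc k)))
  twinsAtFront k = cartesianProductWith joinTwins (allGraphs k) (compatibleRows k)

  ∈-twinsAtFront : ∀ {k} (S : MixedGraph m n (suc (suc k))) → Twins S zero (suc zero) →
    S ∈ twinsAtFront k
  ∈-twinsAtFront (extend (extend G s) (.none ∷ r)) (_ , refl , compat) =
    ∈-cartesianProductWith⁺ joinTwins (∈-allGraphs G)
      (∈-compatibleRows r s λ w → compat (suc (suc w)))

transpose-second : ∀ {k} (i j : Fin k) → transpose i j j ≡ i
transpose-second i j with j ≟ᶠ i
... | yes j≡i = j≡i
... | no _ with j ≟ᶠ j
...   | yes _   = refl
...   | no j≢j  = ⊥-elim (j≢j refl)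

transpose-other : ∀ {k} (i j x : Fin k) → x ≢ i → x ≢ j → transpose i j x ≡ x
transpose-other i j x x≢i x≢j with x ≟ᶠ i
... | yes x≡i = ⊥-elim (x≢i x≡i)
... | no _ with x ≟ᶠ j
...   | yes x≡j = ⊥-elim (x≢j x≡j)
...   | no _    = refl

module _ {k : ℕ} (u v : Fin (suc (suc k))) where

  private
    -- where v sits after swapping 0 and u
    v′ : Fin (suc (suc k))
    v′ = transpose zero u v

  place unplace : Fin (suc (suc k)) → Fin (suc (suc k))
  place   x = transpose u zero (transpose v′ (suc zero) x)
  unplace x = transpose (suc zero) v′ (transpose zero u x)

  place∘unplace : ∀ x → place (unplace x) ≡ x
  place∘unplace x =
    trans (cong (transpose u zero) (transpose-inverse v′ (suc zero) {transpose zero u x}))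
          (transpose-inverse u zero {x})

  place-one : place (suc zero) ≡ v
  place-one =
    trans (cong (transpose u zero) (transpose-second v′ (suc zero))) (transpose-inverse u zero)

  place-zero : u ≢ v → place zero ≡ u
  place-zero u≢v =
    trans (cong (transpose u zero) (transpose-other v′ (suc zero) zero 0≢v′ λ ()))
          (transpose-second u zero)
    where
    0≢v′ : zero ≢ v′
    0≢v′ 0≡v′ = u≢v (trans (sym (transpose-second u zero))
                      (trans (cong (transpose u zero) 0≡v′) (transpose-inverse u zero)))

module _ {m n : ℕ} where

  candidates : ∀ k → List (MixedGraph m n (suc (suc k)))
  candidates k = cartesianProductWith relabel
    (cartesianProductWith unplace (allFin (suc (suc k))) (allFin (suc (suc k)))) (twinsAtFront k)

  length-candidates : ∀ k → length (candidates k) ≡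
    (suc (suc k) * suc (suc k)) * (suc (n + (m + m)) ^ (k C 2) * length (compatiblePairs {m} {n}) ^ k)
  length-candidates k = begin
    length (candidates k)
      ≡⟨ length-cartesianProductWith relabel unplaces (twinsAtFront k) ⟩
    length unplaces * length (twinsAtFront k)
      ≡⟨ cong₂ _*_ (length-cartesianProductWith unplace (allFin K) (allFin K))
                   (length-cartesianProductWith joinTwins (allGraphs k) (compatibleRows k)) ⟩
    (length (allFin K) * length (allFin K)) * (length (allGraphs k) * length (compatibleRows k))
      ≡⟨ cong₂ _*_ (cong₂ _*_ (length-tabulate {n = K} (λ x → x)) (length-tabulate {n = K} (λ x → x)))
                   (cong₂ _*_ (length-allGraphs k) (length-compatibleRows k)) ⟩
    (K * K) * (suc (n + (m + m)) ^ (k C 2) * length (compatiblePairs {m} {n}) ^ k) ∎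
    where
    open ≡-Reasoning
    K = suc (suc k)
    unplaces = cartesianProductWith unplace (allFin K) (allFin K)

  twins⇒∈candidates : ∀ {k} (G : MixedGraph m n (suc (suc k))) → ∃₂ (Twins G) → G ∈ candidates k
  twins⇒∈candidates {k} G (u , v , twins@(u≢v , _)) =
    subst (_∈ candidates k) (sym G≡) (∈-cartesianProductWith⁺ relabel
      (∈-cartesianProductWith⁺ unplace (∈-allFin u) (∈-allFin v)) (∈-twinsAtFront S S-twins))
    where
    S = relabel (place u v) G
    S-twins : Twins S zero (suc zero)
    S-twins = twins-relabel (place u v) {G} (λ ())
      (subst₂ (Twins G) (sym (place-zero u v u≢v)) (sym (place-one u v)) twins)
    G≡ : G ≡ relabel (unplace u v) S
    G≡ = graph-ext G (relabel (unplace u v) S) λ a b → sym (begin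
      adj (relabel (unplace u v) S) a b
        ≡⟨ adj-relabel (unplace u v) S a b ⟩
      adj S (unplace u v a) (unplace u v b)
        ≡⟨ adj-relabel (place u v) G (unplace u v a) (unplace u v b) ⟩
      adj G (place u v (unplace u v a)) (place u v (unplace u v b))
        ≡⟨ cong₂ (adj G) (place∘unplace u v a) (place∘unplace u v b) ⟩
      adj G a b ∎)
      where open ≡-Reasoning

  -- Being in
  -- the candidate list follows only doubly negated from ¬ IsClique, but the inequality
  -- is decidable, hence stable under double negation.
  nonCliques-length≤ : ∀ {k} (L : List (MixedGraph m n (suc (suc k)))) → Unique L →
    All (λ G → ¬ IsClique G) L → length L ≤ length (candidates k)
  nonCliques-length≤ {k} L uniq nonCliques =
    decidable-stable (length L ≤? length (candidates k))
      (¬¬-map (λ all → unique-⊆⇒length≤ uniq (All.lookup all))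
        (All.mapM 0ℓ ¬¬-Monad (λ {G} ¬clique → ¬¬-map (in-candidates G) ¬clique) nonCliques))
    where
    in-candidates : ∀ G → HomToSmaller G → G ∈ candidates k
    in-candidates G hom = twins⇒∈candidates G (smaller⇒twins {G = G} hom)

geometric-bound : ∀ (f : ℕ → ℕ) r a → (∀ k → a ≤ k → f (suc k) ≤ r * f k) →
  ∀ j → f (a + j) ≤ f a * r ^ j
geometric-bound f r a step zero =
  ≤-reflexive (trans (cong f (+-identityʳ a)) (sym (*-identityʳ (f a))))
geometric-bound f r a step (suc j) = begin
  f (a + suc j)       ≡⟨ cong f (+-suc a j) ⟩
  f (suc (a + j))     ≤⟨ step (a + j) (m≤m+n a j) ⟩
  r * f (a + j)       ≤⟨ *-monoʳ-≤ r (geometric-bound f r a step j) ⟩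
  r * (f a * r ^ j)   ≡⟨ swap-front r (f a) (r ^ j) ⟩
  f a * (r * r ^ j)   ∎
  where
  open ≤-Reasoning
  swap-front : ∀ x y z → x * (y * z) ≡ y * (x * z)
  swap-front = solve-∀

cube-step : ∀ q x → 1 ≤ x → 7 * q ≤ x → q * (suc x * suc x * suc x) ≤ suc q * (x * x * x)
cube-step q x 1≤x 7q≤x = begin
  q * (suc x * suc x * suc x)
    ≡⟨ expand q x ⟩
  q * (x * x * x) + q * (3 * (x * x) + 3 * x + 1)
    ≤⟨ +-monoʳ-≤ (q * (x * x * x)) (*-monoʳ-≤ q lower-terms) ⟩
  q * (x * x * x) + q * (7 * (x * x))
    ≡⟨ cong (q * (x * x * x) +_) (regroup q x) ⟩
  q * (x * x * x) + (7 * q) * (x * x)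
    ≤⟨ +-monoʳ-≤ (q * (x * x * x)) (*-monoˡ-≤ (x * x) 7q≤x) ⟩
  q * (x * x * x) + x * (x * x)
    ≡⟨ collect q x ⟩
  suc q * (x * x * x) ∎
  where
  open ≤-Reasoning
  expand : ∀ q x → q * (suc x * suc x * suc x) ≡ q * (x * x * x) + q * (3 * (x * x) + 3 * x + 1)
  expand = solve-∀
  regroup : ∀ q x → q * (7 * (x * x)) ≡ (7 * q) * (x * x)
  regroup = solve-∀
  collect : ∀ q x → q * (x * x * x) + x * (x * x) ≡ suc q * (x * x * x)
  collect = solve-∀
  seven : ∀ x → 3 * (x * x) + 3 * (x * x) + x * x ≡ 7 * (x * x)
  seven = solve-∀
  x≤x² : x ≤ x * x
  x≤x² = subst (_≤ x * x) (*-identityʳ x) (*-monoʳ-≤ x 1≤x)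
  lower-terms : 3 * (x * x) + 3 * x + 1 ≤ 7 * (x * x)
  lower-terms = begin
    3 * (x * x) + 3 * x + 1
      ≤⟨ +-mono-≤ (+-monoʳ-≤ (3 * (x * x)) (*-monoʳ-≤ 3 x≤x²)) (≤-trans 1≤x x≤x²) ⟩
    3 * (x * x) + 3 * (x * x) + x * x
      ≡⟨ seven x ⟩
    7 * (x * x) ∎

exp-beats-poly : ∀ q N → ∃ λ K → ∀ k → K ≤ k → N * (2 + k) * (2 + k) * q ^ k ≤ suc q ^ k
exp-beats-poly q N = a + N * f a , bound
  where
  open ≤-Reasoning
  -- f k = (k+2)³ q^k grows by at most a factor q+1 per step once k ≥ a = 7q
  f : ℕ → ℕ
  f k = (2 + k) * (2 + k) * (2 + k) * q ^ k
  a = 7 * q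
  step : ∀ k → a ≤ k → f (suc k) ≤ suc q * f k
  step k a≤k = begin
    f (suc k)                                        ≡⟨ shift q (2 + k) (q ^ k) ⟩
    (q * (suc (2 + k) * suc (2 + k) * suc (2 + k))) * q ^ k
      ≤⟨ *-monoˡ-≤ (q ^ k) (cube-step q (2 + k) (s≤s z≤n) (≤-trans a≤k (m≤n+m k 2))) ⟩
    (suc q * ((2 + k) * (2 + k) * (2 + k))) * q ^ k
      ≡⟨ *-assoc (suc q) ((2 + k) * (2 + k) * (2 + k)) (q ^ k) ⟩
    suc q * f k                                      ∎
    where
    shift : ∀ q y p → suc y * suc y * suc y * (q * p) ≡ (q * (suc y * suc y * suc y)) * p
    shift = solve-∀
  bound : ∀ k → a + N * f a ≤ k → N * (2 + k) * (2 + k) * q ^ k ≤ suc q ^ k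
  bound k K≤k = *-cancelˡ-≤ (2 + k) (begin
    (2 + k) * (N * (2 + k) * (2 + k) * q ^ k) ≡⟨ regroup N (2 + k) (q ^ k) ⟩
    N * f k                                   ≡⟨ cong (λ i → N * f i) (sym a+j≡k) ⟩
    N * f (a + j)                             ≤⟨ *-monoʳ-≤ N (geometric-bound f (suc q) a step j) ⟩
    N * (f a * suc q ^ j)                     ≡⟨ sym (*-assoc N (f a) (suc q ^ j)) ⟩
    N * f a * suc q ^ j                       ≤⟨ *-mono-≤ Nfa≤2+k (^-monoʳ-≤ (suc q) (m≤n+m j a)) ⟩
    (2 + k) * suc q ^ (a + j)                 ≡⟨ cong (λ i → (2 + k) * suc q ^ i) a+j≡k ⟩
    (2 + k) * suc q ^ k                       ∎)
    where
    j = k ∸ a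
    a+j≡k : a + j ≡ k
    a+j≡k = m+[n∸m]≡n (≤-trans (m≤m+n a _) K≤k)
    Nfa≤2+k : N * f a ≤ 2 + k
    Nfa≤2+k = ≤-trans (m≤n+m _ a) (≤-trans K≤k (m≤n+m k 2))
    regroup : ∀ N x p → x * (N * x * x * p) ≡ N * (x * x * x * p)
    regroup = solve-∀

compatible-count : ∀ d → 2 ≤ d → suc (suc d + (d + d)) ≤ suc d ^ 2
compatible-count (suc zero) (s≤s ())
compatible-count (suc (suc e)) _ = ≤-trans (m≤m+n _ _) (≤-reflexive (sym (slack e)))
  where
  slack : ∀ e → suc (suc (suc e)) * (suc (suc (suc e)) * 1)
              ≡ suc (suc (suc (suc e)) + (suc (suc e) + suc (suc e))) + (e * e + 3 * e + 1)
  slack = solve-∀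

two-present : ∀ m n → (m , n) ≢ (0 , 1) → (m , n) ≢ (0 , 0) → 2 ≤ n + (m + m)
two-present zero    zero          ≢01 ≢00 = ⊥-elim (≢00 refl)
two-present zero    (suc zero)    ≢01 ≢00 = ⊥-elim (≢01 refl)
two-present zero    (suc (suc n)) ≢01 ≢00 = s≤s (s≤s z≤n)
two-present (suc m) n             ≢01 ≢00 =
  ≤-trans (s≤s (s≤s z≤n)) (≤-trans (≤-reflexive (sym (+-suc (suc m) m))) (m≤n+m (suc m + suc m) n))

C-2-step : ∀ k → suc (suc k) C 2 ≡ k C 2 + (k + suc k)
C-2-step k = begin
  suc (suc k) C 2        ≡⟨ suc-C-2 (suc k) ⟩
  suc k C 2 + suc k      ≡⟨ cong (_+ suc k) (suc-C-2 k) ⟩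
  k C 2 + k + suc k      ≡⟨ +-assoc (k C 2) k (suc k) ⟩
  k C 2 + (k + suc k)    ∎
  where open ≡-Reasoning

candidates-fraction : ∀ d q N k → suc q ≤ suc d ^ 2 → N * (2 + k) * (2 + k) * q ^ k ≤ suc q ^ k →
  N * ((2 + k) * (2 + k) * (suc d ^ (k C 2) * q ^ k)) ≤ suc d ^ (suc (suc k) C 2)
candidates-fraction d q N k q+1≤s² poly≤exp = begin
  N * ((2 + k) * (2 + k) * (T * q ^ k))  ≡⟨ regroup N (2 + k) T (q ^ k) ⟩
  T * (N * (2 + k) * (2 + k) * q ^ k)    ≤⟨ *-monoʳ-≤ T poly≤exp ⟩
  T * suc q ^ k                          ≤⟨ *-monoʳ-≤ T (^-monoˡ-≤ k q+1≤s²) ⟩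
  T * (s ^ 2) ^ k                        ≡⟨ cong (T *_) (^-*-assoc s 2 k) ⟩
  T * s ^ (2 * k)                        ≤⟨ *-monoʳ-≤ T (^-monoʳ-≤ s 2k≤2k+1) ⟩
  T * s ^ (k + suc k)                    ≡⟨ sym (^-distribˡ-+-* s (k C 2) (k + suc k)) ⟩
  s ^ (k C 2 + (k + suc k))              ≡⟨ cong (s ^_) (sym (C-2-step k)) ⟩
  s ^ (suc (suc k) C 2)                  ∎
  where
  open ≤-Reasoning
  s = suc d
  T = s ^ (k C 2)
  regroup : ∀ N K T p → N * (K * K * (T * p)) ≡ T * (N * K * K * p)
  regroup = solve-∀
  odd : ∀ k → suc (2 * k) ≡ k + suc k
  odd = solve-∀
  2k≤2k+1 : 2 * k ≤ k + suc k
  2k≤2k+1 = ≤-trans (n≤1+n (2 * k)) (≤-reflexive (odd k))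

theorem1 : (m n : ℕ) → (m , n) ≢ (0 , 1) → (m , n) ≢ (0 , 0) →
    (N : ℕ) → N ≥ 1 → ∃ λ K → (k : ℕ) → k ≥ K →
    (L : List (MixedGraph m n k)) → Unique L → All (λ G → ¬ IsClique G) L →
    N * length L ≤ total m n k
theorem1 m n ≢01 ≢00 N _ = 2 + K₀ , bound
  where
  d = n + (m + m)
  q = length (compatiblePairs {m} {n})
  K₀ = proj₁ (exp-beats-poly q N)
  poly≤exp = proj₂ (exp-beats-poly q N)
  bound : (k : ℕ) → k ≥ 2 + K₀ → (L : List (MixedGraph m n k)) → Unique L →
    All (λ G → ¬ IsClique G) L → N * length L ≤ total m n k
  bound (suc (suc k)) (s≤s (s≤s K₀≤k)) L uniq nonCliques = begin
    N * length L                     ≤⟨ *-monoʳ-≤ N (nonCliques-length≤ L uniq nonCliques) ⟩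
    N * length (candidates k)        ≡⟨ cong (N *_) (length-candidates k) ⟩
    N * ((2 + k) * (2 + k) * (suc d ^ (k C 2) * q ^ k))
      ≤⟨ candidates-fraction d q N k q+1≤s² (poly≤exp k K₀≤k) ⟩
    suc d ^ (suc (suc k) C 2)        ≡⟨ cong (_^ (suc (suc k) C 2)) (types m n) ⟩
    total m n (suc (suc k))          ∎
    where
    open ≤-Reasoning
    q+1≤s² : suc q ≤ suc d ^ 2
    q+1≤s² = subst (λ x → suc x ≤ suc d ^ 2) (sym (length-compatiblePairs {m} {n}))
      (compatible-count d (two-present m n ≢01 ≢00))
    types : ∀ m n → suc (n + (m + m)) ≡ 2 * m + n + 1
    types = solve-∀
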